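{- Let $\lambda\ge 0$, $\eta$ and $\alpha_1,\dots,\alpha_\lambda$ be integers with $0<\alpha_1<\cdots<\alpha_\lambda<\eta$ and $\alpha_i=\eta-\alpha_{\lambda+1-i}$, and let $k,r$ be integers with $k\ge r\ge\lambda\ge0$ and $0\le\lambda<k-1$. Let $\mu=(\mu_1,\ldots,\mu_\ell)\in\overline{\mathcal{B}}_1(\alpha_1,\ldots,\alpha_\lambda;\eta,k,r)$ and let $\{\mu_{i+l}\}_{0\le l\le k-2}$ and $\{\mu_{j+l}\}_{0\le l\le k-2}$ be two $(k-1)$-sets of $\mu$. If $\mu_j>\mu_i$ and $\mu_{i+k-2}\ge\mu_j-2\eta$, with strict inequality if $\mu_j$ is overlined, then these two $(k-1)$-sets are of the same type.
   Context: Overpartitions: the first occurrence of a part size may be overlined. Parts are ordered $1<\bar1<2<\bar2<\cdots$; $\mu=(\mu_1,\dots,\mu_\ell)$ with $\mu_1\ge\cdots\ge\mu_\ell$ in this order; inequalities between parts are in this order, and $x\pm c\eta$ is the part of size $|x|\pm c\eta$ overlined iff $x$ is. $[x/\eta]=\lfloor|x|/\eta\rfloor$; $\overline{V}_\mu(N)$ is the number of overlined parts of $\mu$ that are $\le N$. $\overline{\mathcal{B}}_1(\alpha_1,\ldots,\alpha_\lambda;\eta,k,r)$ is the set of overpartitions $\mu=(\mu_1,\dots,\mu_\ell)$ such that: every part has size $\equiv 0,\alpha_1,\ldots,\alpha_\lambda\pmod\eta$; only parts whose size is a multiple of $\eta$ may be non-overlined; $\mu_i\ge\mu_{i+k-1}+\eta$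 whenever $i+k-1\le\ell$, with strict inequality if $\mu_i$ is non-overlined; at most $r-1$ parts satisfy $\mu_i\le\eta$. A $(k-1)$-set of $\mu$ is a block of consecutive parts $\mu_i\ge\mu_{i+1}\ge\cdots\ge\mu_{i+k-2}$ with $\mu_i\le\mu_{i+k-2}+\eta$, strict inequality if $\mu_i$ is overlined. It is of even type if $[\mu_i/\eta]+\cdots+[\mu_{i+k-2}/\eta]\equiv r-1+\overline{V}_\mu(\mu_i)\pmod 2$, and of odd type otherwise. -}

module Defs where

open import Data.Nat using (ℕ; zero; suc; _+_; _*_; _∸_; _≤_; _<_; _≤ᵇ_; NonZero)
open import Data.Nat.DivMod using (_/_; _%_)
open import Data.Bool using (Bool; true; false; if_then_else_; _∧_)
open import Data.Product using (_×_; _,_; proj₁; proj₂; Σ; ∃)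
open import Data.Sum using (_⊎_)
open import Data.Fin using (Fin; toℕ; opposite) renaming (_<_ to _<ᶠ_)
open import Relation.Binary.PropositionalEquality using (_≡_; _≢_)
open import Relation.Nullary using (¬_)

-- A part of an overpartition: (size , overlined?)
Part : Set
Part = ℕ × Bool

size : Part → ℕ
size = proj₁

Overlined : Part → Set
Overlined p = proj₂ p ≡ true

NonOverlined : Part → Set
NonOverlined p = proj₂ p ≡ false

-- The order 1 < 1̄ < 2 < 2̄ < ⋯ is encoded by the key 2·|x| + [x overlined].
key : Part → ℕ
key (s , b) = 2 * s + (if b then 1 else 0)

_≼_ : Part → Part → Set
x ≼ y = key x ≤ key y

_≺_ : Part → Part → Set
x ≺ y = key x < key y

_⊕_ : Part → ℕ → Part
(s , b) ⊕ c = (s + c , b)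

countTo : (ℕ → Bool) → ℕ → ℕ
countTo f zero = 0
countTo f (suc n) = countTo f n + (if f (suc n) then 1 else 0)

sumBelow : (ℕ → ℕ) → ℕ → ℕ
sumBelow f zero = 0
sumBelow f (suc n) = sumBelow f n + f n

-- An overpartition μ = (μ_1,…,μ_ℓ) is given by its length ℓ and a function
-- μ : ℕ → Part, of which only the values at 1,…,ℓ matter (1-indexed).
InRange : ℕ → ℕ → Set
InRange ℓ i = 1 ≤ i × i ≤ ℓ

-- Overpartition: positive part sizes, nonincreasing in the order above,
-- and overlined parts have distinct sizes (only the first occurrence of a size
-- may be overlined; with the ordering, this first occurrence is the overlined one).
IsOverpartition : ℕ → (ℕ → Part) → Set
IsOverpartition ℓ μ =
  (∀ i → InRange ℓ i → 1 ≤ size (μ i)) ×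
  (∀ i → InRange ℓ i → i < ℓ → μ (suc i) ≼ μ i) ×
  (∀ i j → InRange ℓ i → InRange ℓ j → i ≢ j →
      Overlined (μ i) → Overlined (μ j) → size (μ i) ≢ size (μ j))

Vbar : ℕ → (ℕ → Part) → Part → ℕ
Vbar ℓ μ N = countTo (λ i → proj₂ (μ i) ∧ (key (μ i) ≤ᵇ key N)) ℓ

partNO : ℕ → Part
partNO η = (η , false)

InB1 : (λ' : ℕ) (α : Fin λ' → ℕ) (η : ℕ) .{{_ : NonZero η}} (k r : ℕ)
       (ℓ : ℕ) (μ : ℕ → Part) → Set
InB1 λ' α η k r ℓ μ =
  IsOverpartition ℓ μ ×
  (∀ i → InRange ℓ i →
      (size (μ i) % η ≡ 0) ⊎ (Σ (Fin λ') λ a → size (μ i) % η ≡ α a % η)) ×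
  (∀ i → InRange ℓ i → NonOverlined (μ i) → size (μ i) % η ≡ 0) ×
  (∀ i → 1 ≤ i → i + k ∸ 1 ≤ ℓ →
      (μ (i + k ∸ 1) ⊕ η) ≼ μ i ×
      (NonOverlined (μ i) → (μ (i + k ∸ 1) ⊕ η) ≺ μ i)) ×
  (countTo (λ i → key (μ i) ≤ᵇ key (partNO η)) ℓ < r)

-- {μ_{i+l}}_{0≤l≤k-2} is a (k−1)-set of μ
-- (the chain μ_i ≥ ⋯ ≥ μ_{i+k-2} is automatic for an overpartition).
IsKSet : (η k ℓ : ℕ) (μ : ℕ → Part) (i : ℕ) → Set
IsKSet η k ℓ μ i =
  1 ≤ i × i + k ∸ 2 ≤ ℓ ×
  μ i ≼ (μ (i + k ∸ 2) ⊕ η) ×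
  (Overlined (μ i) → μ i ≺ (μ (i + k ∸ 2) ⊕ η))

-- The (k−1)-set starting at i is of even type:
-- [μ_i/η] + ⋯ + [μ_{i+k-2}/η] ≡ r − 1 + V̄_μ(μ_i) (mod 2),
-- written equivalently without subtraction as  (sum + 1) ≡ r + V̄ (mod 2).
EvenType : (η : ℕ) .{{_ : NonZero η}} (k r ℓ : ℕ) (μ : ℕ → Part) (i : ℕ) → Set
EvenType η k r ℓ μ i =
  (sumBelow (λ l → size (μ (i + l)) / η) (k ∸ 1) + 1) % 2
    ≡ (r + Vbar ℓ μ (μ i)) % 2

OddType : (η : ℕ) .{{_ : NonZero η}} (k r ℓ : ℕ) (μ : ℕ → Part) (i : ℕ) → Set
OddType η k r ℓ μ i = ¬ EvenType η k r ℓ μ i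

SameType : (η : ℕ) .{{_ : NonZero η}} (k r ℓ : ℕ) (μ : ℕ → Part) (i j : ℕ) → Set
SameType η k r ℓ μ i j =
  (EvenType η k r ℓ μ i × EvenType η k r ℓ μ j) ⊎
  (OddType η k r ℓ μ i × OddType η k r ℓ μ j)

-- The type of the (k−1)-set starting at t is the parity of
--   E(t) = [μ_t/η] + ⋯ + [μ_{t+k−2}/η] + V̄_μ(μ_t)   (compared with r − 1),
-- so it suffices that E(t) = E(t+1) + 2 for j ≤ t < i.  Sliding the set by one replaces
-- [μ_t/η] by [μ_{t+k−1}/η], and V̄ drops by one exactly when μ_t is overlined; hence we need
--   [μ_t/η] + [μ_t overlined] = [μ_{t+k−1}/η] + 2.
-- The difference condition gives μ_{t+k−1} + η ≤ μ_t ≤ μ_{t+k−1} + 2η, which settles a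
-- non-overlined μ_t (its size is a multiple of η).  If μ_t is overlined and
-- [μ_t/η] ≥ [μ_{t+k−1}/η] + 2, then the numbers |μ_x| (j ≤ x < t), |μ_{x+k−1}| + η
-- (t ≤ x < i) and |μ_x| + η (i ≤ x ≤ j+k−2) would be k−1 distinct numbers in the window
-- [|μ_{i+k−2}| + η, |μ_{i+k−2}| + 2η), each congruent mod η to the size of a part not
-- divisible by η.  Such sizes lie in the λ < k−1 residue classes of the α_a, contradicting
-- the pigeonhole principle.
module Submission where

open import Defs
open import Data.Nat using (ℕ; _+_; _*_; _∸_; _≤_; _<_; NonZero)
open import Data.Fin using (Fin; toℕ; opposite) renaming (_<_ to _<ᶠ_)
open import Relation.Binary.PropositionalEquality using (_≡_)
open import Data.Nat using (zero; suc; z≤n; s≤s; _≤ᵇ_; _≤?_; _<?_; _≟_)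
open import Data.Nat.Properties
open import Data.Nat.DivMod
open import Data.Nat.Solver using (module +-*-Solver)
open import Data.Bool using (Bool; true; false; if_then_else_; _∧_)
open import Data.Product using (∃; _×_; _,_; proj₁; proj₂)
open import Data.Sum using (_⊎_; inj₁; inj₂; [_,_]′)
open import Data.Empty using (⊥; ⊥-elim)
open import Function using (_∘_; id)
open import Function.Definitions using (Injective)
open import Function.Bundles using (_⇔_; mk⇔; Equivalence)
import Function.Properties.Equivalence as ⇔
open import Relation.Nullary using (¬_; Dec; yes; no)
open import Relation.Nullary.Decidable using (dec-true; dec-false)
open import Relation.Binary.Definitions using (Tri; tri<; tri≈; tri>)
open import Relation.Binary.PropositionalEquality
  using (_≢_; refl; sym; trans; cong; cong₂; subst; module ≡-Reasoning)
import Data.Fin.Properties as Fin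

open +-*-Solver using (solve; _:+_; _:*_; con; _:=_)
open import Algebra.Properties.CommutativeSemigroup +-commutativeSemigroup using (xy∙z≈xz∙y)

ι : Bool → ℕ
ι b = if b then 1 else 0

ι≤1 : ∀ b → ι b ≤ 1
ι≤1 true  = ≤-refl
ι≤1 false = z≤n

key-⊕ : ∀ x c → key (x ⊕ c) ≡ key x + 2 * c
key-⊕ (s , b) c =
  solve 3 (λ s c o → con 2 :* (s :+ c) :+ o := con 2 :* s :+ o :+ con 2 :* c) refl s c (ι b)

⊕-monoˡ-≼ : ∀ {x y} c → x ≼ y → (x ⊕ c) ≼ (y ⊕ c)
⊕-monoˡ-≼ {x} {y} c x≼y = begin
  key (x ⊕ c)     ≡⟨ key-⊕ x c ⟩
  key x + 2 * c   ≤⟨ +-monoˡ-≤ (2 * c) x≼y ⟩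
  key y + 2 * c   ≡⟨ key-⊕ y c ⟨
  key (y ⊕ c)     ∎
  where open ≤-Reasoning

size<⇒≺ : ∀ {x y} → size x < size y → x ≺ y
size<⇒≺ {s , b} {s' , b'} s<s' = begin-strict
  2 * s + ι b   <⟨ +-monoʳ-< (2 * s) (s≤s (ι≤1 b)) ⟩
  2 * s + 2     ≡⟨ +-comm (2 * s) 2 ⟩
  2 + 2 * s     ≡⟨ *-suc 2 s ⟨
  2 * suc s     ≤⟨ *-monoʳ-≤ 2 s<s' ⟩
  2 * s'        ≤⟨ m≤m+n (2 * s') (ι b') ⟩
  2 * s' + ι b' ∎
  where open ≤-Reasoning

≼⇒size≤ : ∀ {x y} → x ≼ y → size x ≤ size y
≼⇒size≤ x≼y = ≮⇒≥ λ y<x → <⇒≱ (size<⇒≺ y<x) x≼y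

overlined-≺⇒size< : ∀ {x y} → Overlined x → x ≺ y → size x < size y
overlined-≺⇒size< {s , true} {s' , b'} refl x≺y = ≰⇒> λ s'≤s → <⇒≱ x≺y (begin
  2 * s' + ι b' ≤⟨ +-monoʳ-≤ (2 * s') (ι≤1 b') ⟩
  2 * s' + 1    ≤⟨ +-monoˡ-≤ 1 (*-monoʳ-≤ 2 s'≤s) ⟩
  2 * s + 1     ∎)
  where open ≤-Reasoning

≺-nonOverlined⇒size< : ∀ {x y} → NonOverlined y → x ≺ y → size x < size y
≺-nonOverlined⇒size< {s , b} {s' , false} refl x≺y = ≰⇒> λ s'≤s → <⇒≱ x≺y (begin
  2 * s' + 0    ≡⟨ +-identityʳ (2 * s') ⟩
  2 * s'        ≤⟨ *-monoʳ-≤ 2 s'≤s ⟩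
  2 * s         ≤⟨ m≤m+n (2 * s) (ι b) ⟩
  2 * s + ι b   ∎)
  where open ≤-Reasoning

odd≢even : ∀ m n → 2 * m + 1 ≢ 2 * n + 0
odd≢even m n eq = 0≢1+n (begin
  0                 ≡⟨ m*n%n≡0 n 2 ⟨
  n * 2 % 2         ≡⟨ cong (_% 2) (solve 1 (λ n → n :* con 2 := con 2 :* n :+ con 0) refl n) ⟩
  (2 * n + 0) % 2   ≡⟨ cong (_% 2) eq ⟨
  (2 * m + 1) % 2   ≡⟨ cong (_% 2) (+-comm (2 * m) 1) ⟩
  (1 + 2 * m) % 2   ≡⟨ cong (_% 2) (cong (1 +_) (*-comm 2 m)) ⟩
  (1 + m * 2) % 2   ≡⟨ [m+kn]%n≡m%n 1 m 2 ⟩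
  1                 ∎)
  where open ≡-Reasoning

key-injective : ∀ {x y} → key x ≡ key y → x ≡ y
key-injective {s , true}  {s' , true}  eq = cong (_, true)  (*-cancelˡ-≡ s s' 2 (+-cancelʳ-≡ _ _ _ eq))
key-injective {s , false} {s' , false} eq = cong (_, false) (*-cancelˡ-≡ s s' 2 (+-cancelʳ-≡ _ _ _ eq))
key-injective {s , true}  {s' , false} eq = ⊥-elim (odd≢even s s' eq)
key-injective {s , false} {s' , true}  eq = ⊥-elim (odd≢even s' s (sym eq))

_⊑_ : Part → Part → Set
x ⊑ y = x ≼ y × (Overlined x → x ≺ y)

⊑-≼-trans : ∀ {x y z} → x ⊑ y → y ≼ z → x ⊑ z
⊑-≼-trans (x≼y , x≺y) y≼z = ≤-trans x≼y y≼z , λ ox → <-≤-trans (x≺y ox) y≼z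

overlined-≼-⊑⇒≺ : ∀ {x y z} → Overlined x → x ≼ y → y ⊑ z → x ≺ z
overlined-≼-⊑⇒≺ {x} {y} ox x≼y (y≼z , y≺z) with m≤n⇒m<n∨m≡n x≼y
... | inj₁ x≺y = <-≤-trans x≺y y≼z
... | inj₂ eq with refl ← key-injective {x} {y} eq = y≺z ox

module _ {η : ℕ} .{{_ : NonZero η}} where

  [1+c]*η≡ : ∀ c → suc c * η ≡ c * η + η
  [1+c]*η≡ c = +-comm η (c * η)

  [2+c]*η≡ : ∀ c → suc (suc c) * η ≡ c * η + 2 * η
  [2+c]*η≡ c = solve 2 (λ c η → (con 2 :+ c) :* η := c :* η :+ con 2 :* η) refl c η

  /-between : ∀ {c x} → c * η ≤ x → x < suc c * η → x / η ≡ c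
  /-between {c} {x} lo hi = ≤-antisym
    (≤-pred (m<n*o⇒m/o<n hi))
    (subst (_≤ x / η) (m*n/n≡m c η) (/-monoˡ-≤ η lo))

  m<[1+m/n]*n : ∀ x → x < suc (x / η) * η
  m<[1+m/n]*n x = begin-strict
    x                   ≡⟨ m≡m%n+[m/n]*n x η ⟩
    x % η + x / η * η   <⟨ +-monoˡ-< (x / η * η) (m%n<n x η) ⟩
    η + x / η * η       ∎
    where open ≤-Reasoning

  %≢0-between : ∀ {c x} → c * η < x → x < suc c * η → x % η ≢ 0
  %≢0-between {c} {x} lo hi x%η≡0 = <-irrefl (sym x≡c*η) lo
    where
    open ≡-Reasoning
    x≡c*η : x ≡ c * η
    x≡c*η = begin
      x                   ≡⟨ m≡m%n+[m/n]*n x η ⟩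
      x % η + x / η * η   ≡⟨ cong₂ (λ r q → r + q * η) x%η≡0 (/-between {c} (<⇒≤ lo) hi) ⟩
      c * η               ∎

  /-of-multiple : ∀ {c x} → x % η ≡ 0 → c * η < x → x < suc (suc c) * η → x / η ≡ suc c
  /-of-multiple {c} {x} x%η≡0 lo hi with suc c * η ≤? x
  ... | yes above = /-between {suc c} above hi
  ... | no below  = ⊥-elim (%≢0-between {c} lo (≰⇒> below) x%η≡0)

  %≡-/<⇒+η≤ : ∀ {u v} → u % η ≡ v % η → u / η < v / η → u + η ≤ v
  %≡-/<⇒+η≤ {u} {v} same u/η<v/η = begin
    u + η                      ≡⟨ cong (_+ η) (m≡m%n+[m/n]*n u η) ⟩
    u % η + u / η * η + η      ≡⟨ +-assoc (u % η) (u / η * η) η ⟩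
    u % η + (u / η * η + η)    ≡⟨ cong₂ _+_ same (+-comm (u / η * η) η) ⟩
    v % η + suc (u / η) * η    ≤⟨ +-monoʳ-≤ (v % η) (*-monoˡ-≤ η u/η<v/η) ⟩
    v % η + v / η * η          ≡⟨ m≡m%n+[m/n]*n v η ⟨
    v                          ∎
    where open ≤-Reasoning

  %-injective-on-window : ∀ {S u v} → S ≤ u → u < S + η → S ≤ v → v < S + η →
                          u % η ≡ v % η → u ≡ v
  %-injective-on-window {S} {u} {v} S≤u u<S+η S≤v v<S+η same with <-cmp (u / η) (v / η)
  ... | tri< u/η<v/η _ _ =
    ⊥-elim (<⇒≱ v<S+η (≤-trans (+-monoˡ-≤ η S≤u) (%≡-/<⇒+η≤ same u/η<v/η)))
  ... | tri> _ _ v/η<u/η =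
    ⊥-elim (<⇒≱ u<S+η (≤-trans (+-monoˡ-≤ η S≤v) (%≡-/<⇒+η≤ (sym same) v/η<u/η)))
  ... | tri≈ _ u/η≡v/η _ = begin
    u                   ≡⟨ m≡m%n+[m/n]*n u η ⟩
    u % η + u / η * η   ≡⟨ cong₂ (λ r q → r + q * η) same u/η≡v/η ⟩
    v % η + v / η * η   ≡⟨ m≡m%n+[m/n]*n v η ⟨
    v                   ∎
    where open ≡-Reasoning

  window-pigeonhole : ∀ {m n S} (α : Fin m → ℕ) (w : Fin n → ℕ) → Injective _≡_ _≡_ w →
                      (∀ y → S ≤ w y) → (∀ y → w y < S + η) →
                      (∀ y → ∃ λ a → w y % η ≡ α a % η) → n ≤ m
  window-pigeonhole α w w-injective lo hi residue = ≮⇒≥ λ m<n →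
    let (y , y' , y<y' , a≡a') = Fin.pigeonhole m<n (proj₁ ∘ residue)
    in Fin.<⇒≢ y<y' (w-injective (%-injective-on-window (lo y) (hi y) (lo y') (hi y')
         (trans (proj₂ (residue y)) (trans (cong (λ a → α a % η) a≡a') (sym (proj₂ (residue y')))))))

+-congʳ-%2 : ∀ x y z → x % 2 ≡ y % 2 → (x + z) % 2 ≡ (y + z) % 2
+-congʳ-%2 x y z x≡y = begin
  (x + z) % 2             ≡⟨ %-distribˡ-+ x z 2 ⟩
  (x % 2 + z % 2) % 2     ≡⟨ cong (λ a → (a + z % 2) % 2) x≡y ⟩
  (y % 2 + z % 2) % 2     ≡⟨ %-distribˡ-+ y z 2 ⟨
  (y + z) % 2             ∎
  where open ≡-Reasoning

[m+n+n]%2≡m%2 : ∀ m n → (m + n + n) % 2 ≡ m % 2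
[m+n+n]%2≡m%2 m n = trans
  (cong (_% 2) (solve 2 (λ m n → m :+ n :+ n := m :+ n :* con 2) refl m n))
  ([m+kn]%n≡m%n m n 2)

even-type⇔ : ∀ W V r → (W + 1) % 2 ≡ (r + V) % 2 ⇔ (W + V + 1) % 2 ≡ r % 2
even-type⇔ W V r = mk⇔ to from
  where
  open ≡-Reasoning
  to : (W + 1) % 2 ≡ (r + V) % 2 → (W + V + 1) % 2 ≡ r % 2
  to eq = begin
    (W + V + 1) % 2   ≡⟨ cong (_% 2) (xy∙z≈xz∙y W V 1) ⟩
    (W + 1 + V) % 2   ≡⟨ +-congʳ-%2 (W + 1) (r + V) V eq ⟩
    (r + V + V) % 2   ≡⟨ [m+n+n]%2≡m%2 r V ⟩
    r % 2             ∎
  from : (W + V + 1) % 2 ≡ r % 2 → (W + 1) % 2 ≡ (r + V) % 2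
  from eq = begin
    (W + 1) % 2           ≡⟨ [m+n+n]%2≡m%2 (W + 1) V ⟨
    (W + 1 + V + V) % 2   ≡⟨ cong (λ a → (a + V) % 2) (xy∙z≈xz∙y W 1 V) ⟩
    (W + V + 1 + V) % 2   ≡⟨ +-congʳ-%2 (W + V + 1) r V eq ⟩
    (r + V) % 2           ∎

even-type-transfer : ∀ {W V W' V'} d r → W + V ≡ W' + V' + 2 * d →
                     (W + 1) % 2 ≡ (r + V) % 2 ⇔ (W' + 1) % 2 ≡ (r + V') % 2
even-type-transfer {W} {V} {W'} {V'} d r eq =
  ⇔.trans (even-type⇔ W V r) (⇔.trans (mk⇔ (trans (sym same)) (trans same))
                                        (⇔.sym (even-type⇔ W' V' r)))
  where
  open ≡-Reasoning
  same : (W + V + 1) % 2 ≡ (W' + V' + 1) % 2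
  same = begin
    (W + V + 1) % 2                ≡⟨ cong (λ a → (a + 1) % 2) eq ⟩
    (W' + V' + 2 * d + 1) % 2      ≡⟨ cong (_% 2) (xy∙z≈xz∙y (W' + V') (2 * d) 1) ⟩
    (W' + V' + 1 + 2 * d) % 2      ≡⟨ cong (λ e → (W' + V' + 1 + e) % 2) (*-comm 2 d) ⟩
    (W' + V' + 1 + d * 2) % 2      ≡⟨ [m+kn]%n≡m%n (W' + V' + 1) d 2 ⟩
    (W' + V' + 1) % 2              ∎

⇔⇒both-or-neither : ∀ {P Q : Set} → Dec P → P ⇔ Q → (P × Q) ⊎ (¬ P × ¬ Q)
⇔⇒both-or-neither (yes p) P⇔Q = inj₁ (p , Equivalence.to P⇔Q p)
⇔⇒both-or-neither (no ¬p) P⇔Q = inj₂ (¬p , ¬p ∘ Equivalence.from P⇔Q)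

≤ᵇ-true : ∀ {x y} → x ≤ y → (x ≤ᵇ y) ≡ true
≤ᵇ-true {x} {y} = dec-true (x ≤? y)

≤ᵇ-false : ∀ {x y} → y < x → (x ≤ᵇ y) ≡ false
≤ᵇ-false {x} {y} y<x = dec-false (x ≤? y) (<⇒≱ y<x)

∧-congˡ-if-true : ∀ o {b b'} → (o ≡ true → b ≡ b') → (o ∧ b) ≡ (o ∧ b')
∧-congˡ-if-true true  b≡b' = b≡b' refl
∧-congˡ-if-true false _    = refl

ι-∧-split : ∀ o {b b'} → (o ≡ true → b ≡ true × b' ≡ false) → ι (o ∧ b) ≡ ι (o ∧ b') + ι o
ι-∧-split true  b,b' with refl , refl ← b,b' refl = refl
ι-∧-split false _    = refl

countTo-cong : ∀ {F G} n → (∀ m → InRange n m → F m ≡ G m) → countTo F n ≡ countTo G n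
countTo-cong zero    F≡G = refl
countTo-cong (suc n) F≡G = cong₂ _+_
  (countTo-cong n λ m (1≤m , m≤n) → F≡G m (1≤m , m≤n⇒m≤1+n m≤n))
  (cong ι (F≡G (suc n) (s≤s z≤n , ≤-refl)))

countTo-differ-at : ∀ {F G} c t n → InRange n t →
                    (∀ m → InRange n m → m ≢ t → F m ≡ G m) →
                    ι (F t) ≡ ι (G t) + c → countTo F n ≡ countTo G n + c
countTo-differ-at c .(suc _) zero (s≤s _ , ()) _ _
countTo-differ-at {F} {G} c t (suc n) (1≤t , t≤1+n) F≡G at-t with t ≟ suc n
... | yes refl = begin
  countTo F n + ι (F (suc n))          ≡⟨ cong₂ _+_ (countTo-cong n below) at-t ⟩
  countTo G n + (ι (G (suc n)) + c)    ≡⟨ +-assoc (countTo G n) _ c ⟨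
  countTo G n + ι (G (suc n)) + c      ∎
  where
  open ≡-Reasoning
  below : ∀ m → InRange n m → F m ≡ G m
  below m (1≤m , m≤n) = F≡G m (1≤m , m≤n⇒m≤1+n m≤n) (λ m≡1+n → <-irrefl m≡1+n (s≤s m≤n))
... | no t≢1+n = begin
  countTo F n + ι (F (suc n))
    ≡⟨ cong₂ _+_ rest (cong ι (F≡G (suc n) (s≤s z≤n , ≤-refl) (t≢1+n ∘ sym))) ⟩
  countTo G n + c + ι (G (suc n))
    ≡⟨ xy∙z≈xz∙y (countTo G n) c (ι (G (suc n))) ⟩
  countTo G n + ι (G (suc n)) + c      ∎
  where
  open ≡-Reasoning
  rest : countTo F n ≡ countTo G n + c
  rest = countTo-differ-at c t n (1≤t , ≤-pred (≤∧≢⇒< t≤1+n t≢1+n))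
           (λ m (1≤m , m≤n) → F≡G m (1≤m , m≤n⇒m≤1+n m≤n)) at-t

sumBelow-slide : ∀ (g : ℕ → ℕ) m n →
                 sumBelow (λ l → g (m + l)) n + g (m + n) ≡ g m + sumBelow (λ l → g (suc m + l)) n
sumBelow-slide g m zero = trans (cong g (+-identityʳ m)) (sym (+-identityʳ (g m)))
sumBelow-slide g m (suc n) = begin
  sumBelow (λ l → g (m + l)) n + g (m + n) + g (m + suc n)
    ≡⟨ cong₂ _+_ (sumBelow-slide g m n) (cong g (+-suc m n)) ⟩
  g m + sumBelow (λ l → g (suc m + l)) n + g (suc m + n)
    ≡⟨ +-assoc (g m) _ _ ⟩
  g m + (sumBelow (λ l → g (suc m + l)) n + g (suc m + n)) ∎
  where open ≡-Reasoning

descent : ∀ (E : ℕ → ℕ) c {j} i → (∀ t → j ≤ t → t < i → E t ≡ E (suc t) + c) →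
          j ≤ i → E j ≡ E i + c * (i ∸ j)
descent E c {j} i step j≤i with m≤n⇒m<n∨m≡n j≤i
descent E c {j} i step j≤i | inj₂ refl = begin
  E j                 ≡⟨ +-identityʳ (E j) ⟨
  E j + 0             ≡⟨ cong (E j +_) (*-zeroʳ c) ⟨
  E j + c * 0         ≡⟨ cong (λ d → E j + c * d) (n∸n≡0 j) ⟨
  E j + c * (j ∸ j)   ∎
  where open ≡-Reasoning
descent E c {j} (suc i) step j≤i | inj₁ (s≤s j≤i') = begin
  E j                          ≡⟨ descent E c i (λ t j≤t t<i → step t j≤t (m<n⇒m<1+n t<i)) j≤i' ⟩
  E i + c * (i ∸ j)            ≡⟨ cong (_+ c * (i ∸ j)) (step i j≤i' ≤-refl) ⟩
  E (suc i) + c + c * (i ∸ j)  ≡⟨ +-assoc (E (suc i)) c _ ⟩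
  E (suc i) + (c + c * (i ∸ j))  ≡⟨ cong (E (suc i) +_) (*-suc c (i ∸ j)) ⟨
  E (suc i) + c * suc (i ∸ j)  ≡⟨ cong (λ d → E (suc i) + c * d) (+-∸-assoc 1 j≤i') ⟨
  E (suc i) + c * (suc i ∸ j)  ∎
  where open ≡-Reasoning

module Overpartition {η : ℕ} .{{_ : NonZero η}} {λ' : ℕ} {α : Fin λ' → ℕ} {k' r ℓ : ℕ}
  {μ : ℕ → Part} (μ∈B1 : InB1 λ' α η (suc (suc k')) r ℓ μ) where

  ordered : ∀ x → InRange ℓ x → x < ℓ → μ (suc x) ≼ μ x
  ordered = proj₁ (proj₂ (proj₁ μ∈B1))

  overlined-sizes-distinct : ∀ x y → InRange ℓ x → InRange ℓ y → x ≢ y →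
    Overlined (μ x) → Overlined (μ y) → size (μ x) ≢ size (μ y)
  overlined-sizes-distinct = proj₂ (proj₂ (proj₁ μ∈B1))

  residue-or-multiple : ∀ x → InRange ℓ x →
    (size (μ x) % η ≡ 0) ⊎ (∃ λ a → size (μ x) % η ≡ α a % η)
  residue-or-multiple = proj₁ (proj₂ μ∈B1)

  nonOverlined⇒multiple : ∀ x → InRange ℓ x → NonOverlined (μ x) → size (μ x) % η ≡ 0
  nonOverlined⇒multiple = proj₁ (proj₂ (proj₂ μ∈B1))

  ≼-antitone : ∀ {x y} → 1 ≤ x → x ≤ y → y ≤ ℓ → μ y ≼ μ x
  ≼-antitone {x} {y} 1≤x x≤y y≤ℓ with m≤n⇒m<n∨m≡n x≤y
  ... | inj₂ refl = ≤-refl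
  ... | inj₁ (s≤s {n = y'} x≤y') =
    ≤-trans (ordered y' (≤-trans 1≤x x≤y' , y'≤ℓ) y≤ℓ) (≼-antitone 1≤x x≤y' y'≤ℓ)
    where
    y'≤ℓ : y' ≤ ℓ
    y'≤ℓ = ≤-trans (n≤1+n y') y≤ℓ

  ≺-if-overlined : ∀ {x y} → 1 ≤ x → x < y → y ≤ ℓ →
                   Overlined (μ x) ⊎ Overlined (μ y) → μ y ≺ μ x
  ≺-if-overlined {x} {y} 1≤x x<y y≤ℓ overlined with m≤n⇒m<n∨m≡n (≼-antitone 1≤x (<⇒≤ x<y) y≤ℓ)
  ... | inj₁ μy≺μx = μy≺μx
  ... | inj₂ same-key =
    ⊥-elim (overlined-sizes-distinct x y x∈ y∈ (<⇒≢ x<y) ox oy (cong size (sym μy≡μx)))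
    where
    μy≡μx : μ y ≡ μ x
    μy≡μx = key-injective {μ y} {μ x} same-key
    x∈ : InRange ℓ x
    x∈ = 1≤x , ≤-trans (<⇒≤ x<y) y≤ℓ
    y∈ : InRange ℓ y
    y∈ = ≤-trans 1≤x (<⇒≤ x<y) , y≤ℓ
    ox : Overlined (μ x)
    ox = [ id , (λ oy → trans (cong proj₂ (sym μy≡μx)) oy) ]′ overlined
    oy : Overlined (μ y)
    oy = [ (λ ox → trans (cong proj₂ μy≡μx) ox) , id ]′ overlined

  overlined-size-decreasing : ∀ {x y} → 1 ≤ x → x < y → y ≤ ℓ → Overlined (μ y) →
                              size (μ y) < size (μ x)
  overlined-size-decreasing 1≤x x<y y≤ℓ oy =
    overlined-≺⇒size< oy (≺-if-overlined 1≤x x<y y≤ℓ (inj₂ oy))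

  overlined-if-%≢0 : ∀ {x} → InRange ℓ x → size (μ x) % η ≢ 0 → Overlined (μ x)
  overlined-if-%≢0 {x} x∈ %≢0 with proj₂ (μ x) in eq
  ... | true  = refl
  ... | false = ⊥-elim (%≢0 (nonOverlined⇒multiple x x∈ eq))

  residue : ∀ {x} → InRange ℓ x → size (μ x) % η ≢ 0 → ∃ λ a → size (μ x) % η ≡ α a % η
  residue {x} x∈ %≢0 = [ ⊥-elim ∘ %≢0 , id ]′ (residue-or-multiple x x∈)

  private
    gap-condition : ∀ {x} → 1 ≤ x → x + suc k' ≤ ℓ →
                    (μ (x + suc k') ⊕ η) ≼ μ x × (NonOverlined (μ x) → (μ (x + suc k') ⊕ η) ≺ μ x)
    gap-condition {x} 1≤x x+k≤ℓ =
      subst (λ z → (μ z ⊕ η) ≼ μ x × (NonOverlined (μ x) → (μ z ⊕ η) ≺ μ x)) index≡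
        (proj₁ (proj₂ (proj₂ (proj₂ μ∈B1))) x 1≤x (subst (_≤ ℓ) (sym index≡) x+k≤ℓ))
      where
      index≡ : x + suc (suc k') ∸ 1 ≡ x + suc k'
      index≡ = +-∸-assoc x {suc (suc k')} (s≤s z≤n)

  gap : ∀ {x} → 1 ≤ x → x + suc k' ≤ ℓ → (μ (x + suc k') ⊕ η) ≼ μ x
  gap 1≤x x+k≤ℓ = proj₁ (gap-condition 1≤x x+k≤ℓ)

  gap-nonOverlined : ∀ {x} → 1 ≤ x → x + suc k' ≤ ℓ → NonOverlined (μ x) → (μ (x + suc k') ⊕ η) ≺ μ x
  gap-nonOverlined 1≤x x+k≤ℓ = proj₂ (gap-condition 1≤x x+k≤ℓ)

  Vbar-step : ∀ {t} → 1 ≤ t → t < ℓ → Vbar ℓ μ (μ t) ≡ Vbar ℓ μ (μ (suc t)) + ι (proj₂ (μ t))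
  Vbar-step {t} 1≤t t<ℓ = countTo-differ-at (ι (proj₂ (μ t))) t ℓ (1≤t , <⇒≤ t<ℓ) elsewhere at-t
    where
    μ[1+t]≼μt : μ (suc t) ≼ μ t
    μ[1+t]≼μt = ordered t (1≤t , <⇒≤ t<ℓ) t<ℓ
    elsewhere : ∀ m → InRange ℓ m → m ≢ t →
      (proj₂ (μ m) ∧ (key (μ m) ≤ᵇ key (μ t))) ≡ (proj₂ (μ m) ∧ (key (μ m) ≤ᵇ key (μ (suc t))))
    elsewhere m (1≤m , m≤ℓ) m≢t = ∧-congˡ-if-true (proj₂ (μ m)) λ om → case-on om (<-cmp m t)
      where
      case-on : Overlined (μ m) → Tri (m < t) (m ≡ t) (t < m) →
                (key (μ m) ≤ᵇ key (μ t)) ≡ (key (μ m) ≤ᵇ key (μ (suc t)))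
      case-on om (tri< m<t _ _) =
        trans (≤ᵇ-false μt≺μm) (sym (≤ᵇ-false (≤-<-trans μ[1+t]≼μt μt≺μm)))
        where
        μt≺μm : μ t ≺ μ m
        μt≺μm = ≺-if-overlined 1≤m m<t (<⇒≤ t<ℓ) (inj₁ om)
      case-on om (tri≈ _ m≡t _) = ⊥-elim (m≢t m≡t)
      case-on om (tri> _ _ t<m) =
        trans (≤ᵇ-true (≤-trans μm≼μ[1+t] μ[1+t]≼μt)) (sym (≤ᵇ-true μm≼μ[1+t]))
        where
        μm≼μ[1+t] : μ m ≼ μ (suc t)
        μm≼μ[1+t] = ≼-antitone (s≤s z≤n) t<m m≤ℓ
    at-t : ι (proj₂ (μ t) ∧ (key (μ t) ≤ᵇ key (μ t)))
         ≡ ι (proj₂ (μ t) ∧ (key (μ t) ≤ᵇ key (μ (suc t)))) + ι (proj₂ (μ t))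
    at-t = ι-∧-split (proj₂ (μ t)) λ ot →
      ≤ᵇ-true (≤-refl {key (μ t)}) , ≤ᵇ-false (≺-if-overlined 1≤t (n<1+n t) t<ℓ (inj₁ ot))

  -- With k = k' + 2, the (k−1)-set starting at x is μ x, …, μ (x + k').
  KSet : ℕ → Set
  KSet x = 1 ≤ x × x + k' ≤ ℓ × μ x ⊑ (μ (x + k') ⊕ η)

  fromIsKSet : ∀ {x} → IsKSet η (suc (suc k')) ℓ μ x → KSet x
  fromIsKSet {x} =
    subst (λ z → 1 ≤ x × z ≤ ℓ × μ x ⊑ (μ z ⊕ η)) (+-∸-assoc x {suc (suc k')} (s≤s (s≤s z≤n)))

  module TwoSets (λ'<k-1 : λ' < suc k') {i j : ℕ} (Kᵢ : KSet i) (Kⱼ : KSet j)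
                 (μi≺μj : μ i ≺ μ j) (μj⊑ : μ j ⊑ (μ (i + k') ⊕ (2 * η))) where

    1≤i : 1 ≤ i
    1≤i = proj₁ Kᵢ
    1≤j : 1 ≤ j
    1≤j = proj₁ Kⱼ
    i+k'≤ℓ : i + k' ≤ ℓ
    i+k'≤ℓ = proj₁ (proj₂ Kᵢ)
    j+k'≤ℓ : j + k' ≤ ℓ
    j+k'≤ℓ = proj₁ (proj₂ Kⱼ)
    set-i : μ i ⊑ (μ (i + k') ⊕ η)
    set-i = proj₂ (proj₂ Kᵢ)
    set-j : μ j ⊑ (μ (j + k') ⊕ η)
    set-j = proj₂ (proj₂ Kⱼ)

    j<i : j < i
    j<i = ≰⇒> λ i≤j → <⇒≱ μi≺μj (≼-antitone 1≤i i≤j (≤-trans (m≤m+n j k') j+k'≤ℓ))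

    s : Part
    s = μ (i + k')
    S : ℕ
    S = size s

    module Step {t : ℕ} (j≤t : j ≤ t) (t<i : t < i) where

      a b : Part
      a = μ (t + suc k')
      b = μ t
      A B q : ℕ
      A = size a
      B = size b
      q = A / η

      1≤t : 1 ≤ t
      1≤t = ≤-trans 1≤j j≤t
      t<ℓ : t < ℓ
      t<ℓ = <-≤-trans t<i (≤-trans (m≤m+n i k') i+k'≤ℓ)
      t+k≤i+k' : t + suc k' ≤ i + k'
      t+k≤i+k' = subst (_≤ i + k') (sym (+-suc t k')) (+-monoˡ-≤ k' t<i)

      b≼μj : b ≼ μ j
      b≼μj = ≼-antitone 1≤j j≤t (<⇒≤ t<ℓ)
      s≼a : s ≼ a
      s≼a = ≼-antitone (≤-trans 1≤t (m≤m+n t (suc k'))) t+k≤i+k' i+k'≤ℓ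
      A+η≤B : A + η ≤ B
      A+η≤B = ≼⇒size≤ (gap 1≤t (≤-trans t+k≤i+k' i+k'≤ℓ))
      B≤A+2η : B ≤ A + 2 * η
      B≤A+2η = ≼⇒size≤ (≤-trans b≼μj (≤-trans (proj₁ μj⊑) (⊕-monoˡ-≼ {s} {a} (2 * η) s≼a)))
      A<[1+q]η : A < suc q * η
      A<[1+q]η = m<[1+m/n]*n A
      [1+q]η≤A+η : suc q * η ≤ A + η
      [1+q]η≤A+η = subst (_≤ A + η) (sym ([1+c]*η≡ q)) (+-monoˡ-≤ η (m/n*n≤m A η))

      module Crowded (ob : Overlined b) ([2+q]η≤B : suc (suc q) * η ≤ B) where

        B<S+2η : B < S + 2 * η
        B<S+2η = overlined-≺⇒size< ob (overlined-≼-⊑⇒≺ {b} {μ j} {s ⊕ (2 * η)} ob b≼μj μj⊑)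
        S<[1+q]η : S < suc q * η
        S<[1+q]η = ≤-<-trans (≼⇒size≤ s≼a) A<[1+q]η
        qη<S : q * η < S
        qη<S = +-cancelʳ-< (2 * η) (q * η) S
                 (subst (_< S + 2 * η) ([2+c]*η≡ q) (≤-<-trans [2+q]η≤B B<S+2η))
        S+η<[2+q]η : S + η < suc (suc q) * η
        S+η<[2+q]η = subst (S + η <_) (sym ([1+c]*η≡ (suc q))) (+-monoˡ-< η S<[1+q]η)
        S+2η<[3+q]η : S + 2 * η < suc (suc (suc q)) * η
        S+2η<[3+q]η = subst (S + 2 * η <_) (sym ([2+c]*η≡ (suc q))) (+-monoˡ-< (2 * η) S<[1+q]η)
        S+2η≡S+η+η : S + 2 * η ≡ S + η + η
        S+2η≡S+η+η = solve 2 (λ S η → S :+ con 2 :* η := S :+ η :+ η) refl S η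
        B<S+η+η : B < S + η + η
        B<S+η+η = subst (B <_) S+2η≡S+η+η B<S+2η

        module Early {x : ℕ} (j≤x : j ≤ x) (x<t : x < t) where
          1≤x : 1 ≤ x
          1≤x = ≤-trans 1≤j j≤x
          x∈ : InRange ℓ x
          x∈ = 1≤x , ≤-trans (<⇒≤ x<t) (<⇒≤ t<ℓ)
          μx≼μj : μ x ≼ μ j
          μx≼μj = ≼-antitone 1≤j j≤x (proj₂ x∈)
          B<μx : B < size (μ x)
          B<μx = overlined-size-decreasing 1≤x x<t (<⇒≤ t<ℓ) ob
          %≢0 : size (μ x) % η ≢ 0
          %≢0 = %≢0-between {c = suc (suc q)} (≤-<-trans [2+q]η≤B B<μx)
                  (≤-<-trans (≼⇒size≤ (≤-trans μx≼μj (proj₁ μj⊑))) S+2η<[3+q]η)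
          overlined : Overlined (μ x)
          overlined = overlined-if-%≢0 x∈ %≢0
          lo : S + η ≤ size (μ x)
          lo = <⇒≤ (<-trans (<-≤-trans S+η<[2+q]η [2+q]η≤B) B<μx)
          hi : size (μ x) < S + η + η
          hi = subst (size (μ x) <_) S+2η≡S+η+η
                 (overlined-≺⇒size< overlined
                   (overlined-≼-⊑⇒≺ {μ x} {μ j} {s ⊕ (2 * η)} overlined μx≼μj μj⊑))

        module Middle {x : ℕ} (t≤x : t ≤ x) (x<i : x < i) where
          y : ℕ
          y = x + suc k'
          1≤y : 1 ≤ y
          1≤y = ≤-trans 1≤t (≤-trans t≤x (m≤m+n x (suc k')))
          y≤i+k' : y ≤ i + k'
          y≤i+k' = subst (_≤ i + k') (sym (+-suc x k')) (+-monoˡ-≤ k' x<i)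
          y∈ : InRange ℓ y
          y∈ = 1≤y , ≤-trans y≤i+k' i+k'≤ℓ
          S≤μy : S ≤ size (μ y)
          S≤μy = ≼⇒size≤ (≼-antitone 1≤y y≤i+k' i+k'≤ℓ)
          μy<[1+q]η : size (μ y) < suc q * η
          μy<[1+q]η = ≤-<-trans
            (≼⇒size≤ (≼-antitone (≤-trans 1≤t (m≤m+n t (suc k'))) (+-monoˡ-≤ (suc k') t≤x) (proj₂ y∈)))
            A<[1+q]η
          %≢0 : size (μ y) % η ≢ 0
          %≢0 = %≢0-between {c = q} (<-≤-trans qη<S S≤μy) μy<[1+q]η
          overlined : Overlined (μ y)
          overlined = overlined-if-%≢0 y∈ %≢0
          μy+η<[2+q]η : size (μ y) + η < suc (suc q) * η
          μy+η<[2+q]η = subst (size (μ y) + η <_) (sym ([1+c]*η≡ (suc q))) (+-monoˡ-< η μy<[1+q]η)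
          lo : S + η ≤ size (μ y) + η
          lo = +-monoˡ-≤ η S≤μy
          hi : size (μ y) + η < S + η + η
          hi = <-trans μy+η<[2+q]η (≤-<-trans [2+q]η≤B B<S+η+η)

        module Late {x : ℕ} (i≤x : i ≤ x) (x≤j+k' : x ≤ j + k') where
          1≤x : 1 ≤ x
          1≤x = ≤-trans 1≤i i≤x
          x∈ : InRange ℓ x
          x∈ = 1≤x , ≤-trans x≤j+k' j+k'≤ℓ
          μx≼μi : μ x ≼ μ i
          μx≼μi = ≼-antitone 1≤i i≤x (proj₂ x∈)
          μj⊑μx⊕η : μ j ⊑ (μ x ⊕ η)
          μj⊑μx⊕η = ⊑-≼-trans {μ j} {μ (j + k') ⊕ η} {μ x ⊕ η} set-j
                      (⊕-monoˡ-≼ {μ (j + k')} {μ x} η (≼-antitone 1≤x x≤j+k' j+k'≤ℓ))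
          B<μx+η : B < size (μ x) + η
          B<μx+η = overlined-≺⇒size< ob (overlined-≼-⊑⇒≺ {b} {μ j} {μ x ⊕ η} ob b≼μj μj⊑μx⊕η)
          [1+q]η<μx : suc q * η < size (μ x)
          [1+q]η<μx = +-cancelʳ-< η _ _
            (subst (_< size (μ x) + η) ([1+c]*η≡ (suc q)) (≤-<-trans [2+q]η≤B B<μx+η))
          %≢0 : size (μ x) % η ≢ 0
          %≢0 = %≢0-between {c = suc q} [1+q]η<μx
                  (≤-<-trans (≼⇒size≤ (≤-trans μx≼μi (proj₁ set-i))) S+η<[2+q]η)
          overlined : Overlined (μ x)
          overlined = overlined-if-%≢0 x∈ %≢0
          lo : S + η ≤ size (μ x) + η
          lo = +-monoˡ-≤ η (<⇒≤ (<-trans S<[1+q]η [1+q]η<μx))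
          hi : size (μ x) + η < S + η + η
          hi = +-monoˡ-< η (overlined-≺⇒size< overlined
                 (overlined-≼-⊑⇒≺ {μ x} {μ i} {s ⊕ η} overlined μx≼μi set-i))

        data Region (x : ℕ) : Set where
          early  : x < t → Region x
          middle : t ≤ x → x < i → Region x
          late   : i ≤ x → Region x

        region : ∀ x → Region x
        region x with x <? t | x <? i
        ... | yes x<t | _       = early x<t
        ... | no x≮t  | yes x<i = middle (≮⇒≥ x≮t) x<i
        ... | no _    | no x≮i  = late (≮⇒≥ x≮i)

        index : ∀ {x} → Region x → ℕ
        index {x} (early _)    = x
        index {x} (middle _ _) = x + suc k'
        index {x} (late _)     = x

        value : ∀ {x} → Region x → ℕ
        value {x} (early _)    = size (μ x)
        value {x} (middle _ _) = size (μ (x + suc k')) + η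
        value {x} (late _)     = size (μ x) + η

        value-% : ∀ {x} (r : Region x) → value r % η ≡ size (μ (index r)) % η
        value-% (early _)    = refl
        value-% (middle _ _) = [m+n]%n≡m%n _ η
        value-% (late _)     = [m+n]%n≡m%n _ η

        module Slot {x : ℕ} (j≤x : j ≤ x) (x≤j+k' : x ≤ j + k') where
          index∈ : (r : Region x) → InRange ℓ (index r)
          index∈ (early x<t)       = Early.x∈ j≤x x<t
          index∈ (middle t≤x x<i)  = Middle.y∈ t≤x x<i
          index∈ (late i≤x)        = Late.x∈ i≤x x≤j+k'

          index-%≢0 : (r : Region x) → size (μ (index r)) % η ≢ 0
          index-%≢0 (early x<t)      = Early.%≢0 j≤x x<t
          index-%≢0 (middle t≤x x<i) = Middle.%≢0 t≤x x<i
          index-%≢0 (late i≤x)       = Late.%≢0 i≤x x≤j+k'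

          value-lo : (r : Region x) → S + η ≤ value r
          value-lo (early x<t)      = Early.lo j≤x x<t
          value-lo (middle t≤x x<i) = Middle.lo t≤x x<i
          value-lo (late i≤x)       = Late.lo i≤x x≤j+k'

          value-hi : (r : Region x) → value r < S + η + η
          value-hi (early x<t)      = Early.hi j≤x x<t
          value-hi (middle t≤x x<i) = Middle.hi t≤x x<i
          value-hi (late i≤x)       = Late.hi i≤x x≤j+k'

        value-distinct : ∀ {x x'} → j ≤ x → x < x' → x' ≤ j + k' →
                         (r : Region x) (r' : Region x') → value r ≢ value r'
        value-distinct {x} {x'} j≤x x<x' x'≤j+k' (early x<t) (early x'<t) = >⇒≢
          (overlined-size-decreasing (Early.1≤x j≤x x<t) x<x' (proj₂ (Early.x∈ j≤x' x'<t))
            (Early.overlined j≤x' x'<t))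
          where
          j≤x' : j ≤ x'
          j≤x' = ≤-trans j≤x (<⇒≤ x<x')
        value-distinct j≤x x<x' x'≤j+k' (early x<t) (middle t≤x' x'<i) = >⇒≢
          (<-trans (Middle.μy+η<[2+q]η t≤x' x'<i) (≤-<-trans [2+q]η≤B (Early.B<μx j≤x x<t)))
        value-distinct {x} {x'} j≤x x<x' x'≤j+k' (early x<t) (late i≤x') = <⇒≢
          (overlined-≺⇒size< (Early.overlined j≤x x<t)
            (overlined-≼-⊑⇒≺ {μ x} {μ j} {μ x' ⊕ η} (Early.overlined j≤x x<t) (Early.μx≼μj j≤x x<t)
              (Late.μj⊑μx⊕η i≤x' x'≤j+k')))
        value-distinct j≤x x<x' x'≤j+k' (middle t≤x x<i) (early x'<t) =
          ⊥-elim (<⇒≱ (<-trans x<x' x'<t) t≤x)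
        value-distinct j≤x x<x' x'≤j+k' (middle t≤x x<i) (middle t≤x' x'<i) = >⇒≢
          (+-monoˡ-< η (overlined-size-decreasing (Middle.1≤y t≤x x<i) (+-monoˡ-< (suc k') x<x')
            (proj₂ (Middle.y∈ t≤x' x'<i)) (Middle.overlined t≤x' x'<i)))
        value-distinct j≤x x<x' x'≤j+k' (middle t≤x x<i) (late i≤x') = <⇒≢
          (<-trans (Middle.μy+η<[2+q]η t≤x x<i) (≤-<-trans [2+q]η≤B (Late.B<μx+η i≤x' x'≤j+k')))
        value-distinct j≤x x<x' x'≤j+k' (late i≤x) (early x'<t) =
          ⊥-elim (<⇒≱ (<-trans (<-trans x<x' x'<t) t<i) i≤x)
        value-distinct j≤x x<x' x'≤j+k' (late i≤x) (middle _ x'<i) =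
          ⊥-elim (<⇒≱ (<-trans x<x' x'<i) i≤x)
        value-distinct {x} {x'} j≤x x<x' x'≤j+k' (late i≤x) (late i≤x') = >⇒≢
          (+-monoˡ-< η (overlined-size-decreasing (Late.1≤x i≤x x≤j+k') x<x'
            (proj₂ (Late.x∈ i≤x' x'≤j+k')) (Late.overlined i≤x' x'≤j+k')))
          where
          x≤j+k' : x ≤ j + k'
          x≤j+k' = ≤-trans (<⇒≤ x<x') x'≤j+k'

        contradiction : ⊥
        contradiction = <⇒≱ λ'<k-1 (window-pigeonhole α w w-injective
          (λ y → Slot.value-lo (j≤slot y) (slot≤j+k' y) (region (slot y)))
          (λ y → Slot.value-hi (j≤slot y) (slot≤j+k' y) (region (slot y)))
          residue-w)
          where
          slot : Fin (suc k') → ℕ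
          slot y = j + toℕ y
          j≤slot : ∀ y → j ≤ slot y
          j≤slot y = m≤m+n j (toℕ y)
          slot≤j+k' : ∀ y → slot y ≤ j + k'
          slot≤j+k' y = +-monoʳ-≤ j (Fin.toℕ≤pred[n] y)
          w : Fin (suc k') → ℕ
          w y = value (region (slot y))
          w-injective : Injective _≡_ _≡_ w
          w-injective {y} {y'} w≡ with <-cmp (toℕ y) (toℕ y')
          ... | tri< y<y' _ _ = ⊥-elim (value-distinct (j≤slot y) (+-monoʳ-< j y<y') (slot≤j+k' y')
                                          (region (slot y)) (region (slot y')) w≡)
          ... | tri≈ _ y≡y' _ = Fin.toℕ-injective y≡y'
          ... | tri> _ _ y'<y = ⊥-elim (value-distinct (j≤slot y') (+-monoʳ-< j y'<y) (slot≤j+k' y)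
                                          (region (slot y')) (region (slot y)) (sym w≡))
          residue-w : ∀ y → ∃ λ a → w y % η ≡ α a % η
          residue-w y =
            let r = region (slot y)
                (a , same) = residue (Slot.index∈ (j≤slot y) (slot≤j+k' y) r)
                                     (Slot.index-%≢0 (j≤slot y) (slot≤j+k' y) r)
            in a , trans (value-% r) same

      floor-step : B / η + ι (proj₂ b) ≡ q + 2
      floor-step with proj₂ b in ob
      ... | false = trans (+-identityʳ (B / η)) (trans B/η≡2+q (+-comm 2 q))
        where
        A+η<B : A + η < B
        A+η<B = ≺-nonOverlined⇒size< ob (gap-nonOverlined 1≤t (≤-trans t+k≤i+k' i+k'≤ℓ) ob)
        B<[3+q]η : B < suc (suc (suc q)) * η
        B<[3+q]η = ≤-<-trans B≤A+2η
          (subst (A + 2 * η <_) (sym ([2+c]*η≡ (suc q))) (+-monoˡ-< (2 * η) A<[1+q]η))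
        B/η≡2+q : B / η ≡ suc (suc q)
        B/η≡2+q = /-of-multiple (nonOverlined⇒multiple t (1≤t , <⇒≤ t<ℓ) ob)
                    (≤-<-trans [1+q]η≤A+η A+η<B) B<[3+q]η
      ... | true = trans (cong (_+ 1) B/η≡1+q) (sym (+-suc q 1))
        where
        B/η≡1+q : B / η ≡ suc q
        B/η≡1+q = /-between {c = suc q} (≤-trans [1+q]η≤A+η A+η≤B) (≰⇒> (Crowded.contradiction ob))

    ⌊μ/η⌋ : ℕ → ℕ
    ⌊μ/η⌋ m = size (μ m) / η

    W V E : ℕ → ℕ
    W m = sumBelow (λ l → ⌊μ/η⌋ (m + l)) (suc k')
    V m = Vbar ℓ μ (μ m)
    E m = W m + V m

    E-step : ∀ t → j ≤ t → t < i → E t ≡ E (suc t) + 2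
    E-step t j≤t t<i = +-cancelʳ-≡ entering _ _ (begin
      W t + V t + entering
        ≡⟨ xy∙z≈xz∙y (W t) (V t) entering ⟩
      W t + entering + V t
        ≡⟨ cong₂ _+_ (sumBelow-slide ⌊μ/η⌋ t (suc k'))
                     (Vbar-step (Step.1≤t j≤t t<i) (Step.t<ℓ j≤t t<i)) ⟩
      ⌊μ/η⌋ t + W (suc t) + (V (suc t) + bit)
        ≡⟨ solve 4 (λ g w v o → g :+ w :+ (v :+ o) := w :+ v :+ (g :+ o)) refl
                   (⌊μ/η⌋ t) (W (suc t)) (V (suc t)) bit ⟩
      E (suc t) + (⌊μ/η⌋ t + bit)
        ≡⟨ cong (E (suc t) +_) (Step.floor-step j≤t t<i) ⟩
      E (suc t) + (entering + 2)
        ≡⟨ cong (E (suc t) +_) (+-comm entering 2) ⟩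
      E (suc t) + (2 + entering)
        ≡⟨ +-assoc (E (suc t)) 2 entering ⟨
      E (suc t) + 2 + entering ∎)
      where
      open ≡-Reasoning
      entering bit : ℕ
      entering = ⌊μ/η⌋ (t + suc k')
      bit = ι (proj₂ (μ t))

    evenType⇔ : EvenType η (suc (suc k')) r ℓ μ i ⇔ EvenType η (suc (suc k')) r ℓ μ j
    evenType⇔ = ⇔.sym (even-type-transfer {W j} {V j} {W i} {V i} (i ∸ j) r
                        (descent E 2 i E-step (<⇒≤ j<i)))

lemma3p2 : (λ' : ℕ) (η : ℕ) .{{_ : NonZero η}} (α : Fin λ' → ℕ) →
    (∀ a → 0 < α a) → (∀ a → α a < η) → (∀ a b → a <ᶠ b → α a < α b) →
    (∀ a → α a ≡ η ∸ α (opposite a)) →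
    (k r : ℕ) → r ≤ k → λ' ≤ r → λ' + 1 < k →
    (ℓ : ℕ) (μ : ℕ → Part) → InB1 λ' α η k r ℓ μ →
    (i j : ℕ) → IsKSet η k ℓ μ i → IsKSet η k ℓ μ j →
    μ i ≺ μ j →
    μ j ≼ (μ (i + k ∸ 2) ⊕ (2 * η)) →
    (Overlined (μ j) → μ j ≺ (μ (i + k ∸ 2) ⊕ (2 * η))) →
    SameType η k r ℓ μ i j
lemma3p2 λ' η α _ _ _ _ (suc zero) r _ _ λ'+1<1 = ⊥-elim (m+n≮n λ' 1 λ'+1<1)
lemma3p2 λ' η α _ _ _ _ (suc (suc k')) r _ _ λ'+1<k ℓ μ μ∈B1 i j set-i set-j μi≺μj μj≼ μj≺ =
  ⇔⇒both-or-neither (_ ≟ _)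
    (TwoSets.evenType⇔ λ'<k-1 (fromIsKSet set-i) (fromIsKSet set-j) μi≺μj μj⊑)
  where
  open Overpartition μ∈B1
  λ'<k-1 : λ' < suc k'
  λ'<k-1 = subst (_≤ suc k') (+-comm λ' 1) (≤-pred λ'+1<k)
  μj⊑ : μ j ⊑ (μ (i + k') ⊕ (2 * η))
  μj⊑ = subst (λ z → μ j ⊑ (μ z ⊕ (2 * η))) (+-∸-assoc i {suc (suc k')} (s≤s (s≤s z≤n)))
              (μj≼ , μj≺)
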